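{- Let $p_1,p_2,\ldots$ be distinct propositional variables and define $\varphi^1=p_1$, $\varphi^{k+1}=\varphi^k\to p_{k+1}$, so that $\varphi^k=(\cdots((p_1\to p_2)\to p_3)\to\cdots\to p_{k-1})\to p_k$. For every $k\geq1$, every closed simply typed lambda term $M$ with $\vdash M:\varphi^k\to\varphi^k$ is $\beta\eta$-convertible to the identity $\lambda x.x$.
   Context: Simply typed lambda calculus à la Church: terms $x\mid\lambda x{:}\sigma.M\mid MN$, types are implicational formulas $\sigma::=p\mid\sigma\to\tau$ with right-associative $\to$, typed by the variable, abstraction and application rules; "proof of a formula" means a closed term of that type. -}

module Defs where

open import Data.Nat using (ℕ; zero; suc)
open import Data.List using (List; []; _∷_)

infixr 7 _⇒_
data Ty : Set where
  atom : ℕ → Ty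
  _⇒_  : Ty → Ty → Ty

Ctx : Set
Ctx = List Ty

infix 4 _∋_
data _∋_ : Ctx → Ty → Set where
  here  : ∀ {Γ A} → (A ∷ Γ) ∋ A
  there : ∀ {Γ A B} → Γ ∋ A → (B ∷ Γ) ∋ A

-- Church-style simply typed terms, intrinsically typed:
-- Tm Γ A is the set of terms M with Γ ⊢ M : A (variable, abstraction,
-- application rules). The binder's type annotation is the domain A.
data Tm (Γ : Ctx) : Ty → Set where
  var : ∀ {A} → Γ ∋ A → Tm Γ A
  lam : ∀ {A B} → Tm (A ∷ Γ) B → Tm Γ (A ⇒ B)
  app : ∀ {A B} → Tm Γ (A ⇒ B) → Tm Γ A → Tm Γ B

Ren : Ctx → Ctx → Set
Ren Γ Δ = ∀ {A} → Γ ∋ A → Δ ∋ A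

ext : ∀ {Γ Δ B} → Ren Γ Δ → Ren (B ∷ Γ) (B ∷ Δ)
ext ρ here      = here
ext ρ (there x) = there (ρ x)

rename : ∀ {Γ Δ A} → Ren Γ Δ → Tm Γ A → Tm Δ A
rename ρ (var x)   = var (ρ x)
rename ρ (lam M)   = lam (rename (ext ρ) M)
rename ρ (app M N) = app (rename ρ M) (rename ρ N)

weaken : ∀ {Γ A B} → Tm Γ A → Tm (B ∷ Γ) A
weaken = rename there

Sub : Ctx → Ctx → Set
Sub Γ Δ = ∀ {A} → Γ ∋ A → Tm Δ A

exts : ∀ {Γ Δ B} → Sub Γ Δ → Sub (B ∷ Γ) (B ∷ Δ)
exts σ here      = var here
exts σ (there x) = weaken (σ x)

subst : ∀ {Γ Δ A} → Sub Γ Δ → Tm Γ A → Tm Δ A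
subst σ (var x)   = σ x
subst σ (lam M)   = lam (subst (exts σ) M)
subst σ (app M N) = app (subst σ M) (subst σ N)

single : ∀ {Γ B} → Tm Γ B → Sub (B ∷ Γ) Γ
single N here      = N
single N (there x) = var x

_[_] : ∀ {Γ A B} → Tm (B ∷ Γ) A → Tm Γ B → Tm Γ A
M [ N ] = subst (single N) M

infix 4 _⟶_
data _⟶_ {Γ : Ctx} : ∀ {A} → Tm Γ A → Tm Γ A → Set where
  β     : ∀ {A B} {M : Tm (A ∷ Γ) B} {N : Tm Γ A} →
          app (lam M) N ⟶ M [ N ]
  η     : ∀ {A B} {M : Tm Γ (A ⇒ B)} →
          lam (app (weaken M) (var here)) ⟶ M
  ξ-lam : ∀ {A B} {M M′ : Tm (A ∷ Γ) B} → M ⟶ M′ → lam M ⟶ lam M′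
  ξ-app₁ : ∀ {A B} {M M′ : Tm Γ (A ⇒ B)} {N : Tm Γ A} →
           M ⟶ M′ → app M N ⟶ app M′ N
  ξ-app₂ : ∀ {A B} {M : Tm Γ (A ⇒ B)} {N N′ : Tm Γ A} →
           N ⟶ N′ → app M N ⟶ app M N′

infix 4 _=βη_
data _=βη_ {Γ : Ctx} {A : Ty} : Tm Γ A → Tm Γ A → Set where
  step   : ∀ {M N} → M ⟶ N → M =βη N
  refl   : ∀ {M} → M =βη M
  sym    : ∀ {M N} → M =βη N → N =βη M
  trans  : ∀ {M N P} → M =βη N → N =βη P → M =βη P

-- φ^1 = p_1, φ^{k+1} = φ^k → p_{k+1}.  (φ 0 is an unused dummy; the
-- statement only concerns k ≥ 1.)
φ : ℕ → Ty
φ zero                = atom zero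
φ (suc zero)          = atom 1
φ (suc (suc k))       = φ (suc k) ⇒ atom (suc (suc k))

idTm : ∀ {Γ} (A : Ty) → Tm Γ (A ⇒ A)
idTm A = lam (var here)

-- Every term is βη-equal to its η-long β-normal form, computed here by
-- normalisation by evaluation, so it suffices to classify the normal forms.
-- A normal form of φᵏ ⇒ φᵏ is λx.N with N a normal form of φᵏ in the context
-- x : φᵏ.  Consider a context whose variables have pairwise distinct types φʲ,
-- all with j ≥ m.  A normal form of φᵐ there is η-equal to the variable of
-- that type: for m = 1 it is that variable, and for m > 1 it is λy.z N, where
-- z : φᵐ is the only variable whose type ends in p_m and N is a normal form of
-- φᵐ⁻¹ in the context extended by y : φᵐ⁻¹; by induction N =βη y, so the
-- term is the η-expansion of z.
module Submission where

open import Defs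
open import Data.Nat using (ℕ; zero; suc; _≤_)
open import Data.Nat.Properties using (≤-refl; <⇒≤; <-irrefl; suc-injective)
open import Data.List using ([]; _∷_)
open import Data.Product using (∃-syntax; _,_; _×_; map₂)
open import Data.Empty using (⊥-elim)
open import Relation.Binary.PropositionalEquality as ≡ using (_≡_; refl; cong; cong₂)
open ≡.≡-Reasoning

private variable
  Γ Δ Θ : Ctx
  A B : Ty
  m i j : ℕ

infixl 5 _◂_
_◂_ : {T : Ty → Set} → (∀ {B} → Γ ∋ B → T B) → T A → ∀ {B} → A ∷ Γ ∋ B → T B
(γ ◂ a) here      = a
(γ ◂ a) (there x) = γ x

infix 4 _≐_
_≐_ : {T : Ty → Set} (f g : ∀ {B} → Γ ∋ B → T B) → Set
f ≐ g = ∀ {B} x → f {B} x ≡ g x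

ext-cong : {ρ ρ′ : Ren Γ Δ} → ρ ≐ ρ′ → ext {B = A} ρ ≐ ext ρ′
ext-cong h here      = refl
ext-cong h (there x) = cong there (h x)

rename-cong : {ρ ρ′ : Ren Γ Δ} → ρ ≐ ρ′ → (M : Tm Γ A) → rename ρ M ≡ rename ρ′ M
rename-cong h (var x)   = cong var (h x)
rename-cong h (lam M)   = cong lam (rename-cong (ext-cong h) M)
rename-cong h (app M N) = cong₂ app (rename-cong h M) (rename-cong h N)

rename-id : (M : Tm Γ A) → rename (λ x → x) M ≡ M
rename-id (var x)   = refl
rename-id (lam M)   = cong lam (≡.trans (rename-cong (λ { here → refl ; (there _) → refl }) M)
                                        (rename-id M))
rename-id (app M N) = cong₂ app (rename-id M) (rename-id N)

rename-∘ : (ρ : Ren Γ Δ) (ρ′ : Ren Δ Θ) (M : Tm Γ A) →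
           rename ρ′ (rename ρ M) ≡ rename (λ x → ρ′ (ρ x)) M
rename-∘ ρ ρ′ (var x)   = refl
rename-∘ ρ ρ′ (lam M)   = cong lam (≡.trans (rename-∘ (ext ρ) (ext ρ′) M)
                                            (rename-cong (λ { here → refl ; (there _) → refl }) M))
rename-∘ ρ ρ′ (app M N) = cong₂ app (rename-∘ ρ ρ′ M) (rename-∘ ρ ρ′ N)

rename-weaken : (ρ : Ren Γ Δ) (M : Tm Γ A) →
                rename (ext {B = B} ρ) (weaken M) ≡ weaken (rename ρ M)
rename-weaken ρ M = ≡.trans (rename-∘ there (ext ρ) M) (≡.sym (rename-∘ ρ there M))

exts-cong : {σ σ′ : Sub Γ Δ} → σ ≐ σ′ → exts {B = A} σ ≐ exts σ′
exts-cong h here      = refl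
exts-cong h (there x) = cong weaken (h x)

subst-cong : {σ σ′ : Sub Γ Δ} → σ ≐ σ′ → (M : Tm Γ A) → subst σ M ≡ subst σ′ M
subst-cong h (var x)   = h x
subst-cong h (lam M)   = cong lam (subst-cong (exts-cong h) M)
subst-cong h (app M N) = cong₂ app (subst-cong h M) (subst-cong h N)

subst-var : (M : Tm Γ A) → subst var M ≡ M
subst-var (var x)   = refl
subst-var (lam M)   = cong lam (≡.trans (subst-cong (λ { here → refl ; (there _) → refl }) M)
                                        (subst-var M))
subst-var (app M N) = cong₂ app (subst-var M) (subst-var N)

subst-rename : (ρ : Ren Γ Δ) (σ : Sub Δ Θ) (M : Tm Γ A) →
               subst σ (rename ρ M) ≡ subst (λ x → σ (ρ x)) M
subst-rename ρ σ (var x)   = refl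
subst-rename ρ σ (lam M)   = cong lam (≡.trans (subst-rename (ext ρ) (exts σ) M)
                                               (subst-cong (λ { here → refl ; (there _) → refl }) M))
subst-rename ρ σ (app M N) = cong₂ app (subst-rename ρ σ M) (subst-rename ρ σ N)

rename-exts : (σ : Sub Γ Δ) (ρ : Ren Δ Θ) →
              (λ {C} x → rename (ext ρ) (exts {B = A} σ {C} x)) ≐ exts (λ x → rename ρ (σ x))
rename-exts σ ρ here      = refl
rename-exts σ ρ (there x) = rename-weaken ρ (σ x)

rename-subst : (σ : Sub Γ Δ) (ρ : Ren Δ Θ) (M : Tm Γ A) →
               rename ρ (subst σ M) ≡ subst (λ x → rename ρ (σ x)) M
rename-subst σ ρ (var x)   = refl
rename-subst σ ρ (lam M)   = cong lam (≡.trans (rename-subst (exts σ) (ext ρ) M)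
                                               (subst-cong (rename-exts σ ρ) M))
rename-subst σ ρ (app M N) = cong₂ app (rename-subst σ ρ M) (rename-subst σ ρ N)

subst-weaken : (σ : Sub Γ Δ) (M : Tm Γ A) →
               subst (exts {B = B} σ) (weaken M) ≡ weaken (subst σ M)
subst-weaken σ M = ≡.trans (subst-rename there (exts σ) M) (≡.sym (rename-subst σ there M))

subst-∘ : (σ : Sub Γ Δ) (τ : Sub Δ Θ) (M : Tm Γ A) →
          subst τ (subst σ M) ≡ subst (λ x → subst τ (σ x)) M
subst-∘ σ τ (var x)   = refl
subst-∘ σ τ (lam M)   = cong lam (≡.trans (subst-∘ (exts σ) (exts τ) M) (subst-cong exts-∘ M))
  where
  exts-∘ : (λ {C} x → subst (exts τ) (exts σ {C} x)) ≐ exts (λ x → subst τ (σ x))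
  exts-∘ here      = refl
  exts-∘ (there x) = subst-weaken τ (σ x)
subst-∘ σ τ (app M N) = cong₂ app (subst-∘ σ τ M) (subst-∘ σ τ N)

weaken-[] : (M : Tm Γ A) (N : Tm Γ B) → weaken M [ N ] ≡ M
weaken-[] M N = ≡.trans (subst-rename there (single N) M) (subst-var M)

subst-exts-[] : (σ : Sub Γ Δ) (M : Tm (A ∷ Γ) B) (N : Tm Δ A) →
                subst (exts σ) M [ N ] ≡ subst (σ ◂ N) M
subst-exts-[] σ M N = ≡.trans (subst-∘ (exts σ) (single N) M) (subst-cong single-exts M)
  where
  single-exts : (λ {C} x → subst (single N) (exts σ {C} x)) ≐ (σ ◂ N)
  single-exts here      = refl
  single-exts (there x) = weaken-[] (σ x) N

rename-[] : (ρ : Ren Γ Δ) (M : Tm (A ∷ Γ) B) (N : Tm Γ A) →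
            rename ρ (M [ N ]) ≡ rename (ext ρ) M [ rename ρ N ]
rename-[] ρ M N = begin
  rename ρ (M [ N ])                          ≡⟨ rename-subst (single N) ρ M ⟩
  subst (λ x → rename ρ (single N x)) M        ≡⟨ subst-cong (λ { here → refl ; (there _) → refl }) M ⟩
  subst (λ x → single (rename ρ N) (ext ρ x)) M ≡⟨ subst-rename (ext ρ) (single (rename ρ N)) M ⟨
  rename (ext ρ) M [ rename ρ N ]              ∎

≡⇒=βη : {M N : Tm Γ A} → M ≡ N → M =βη N
≡⇒=βη refl = refl

=βη-lift : (f : Tm Γ A → Tm Δ B) → (∀ {M N} → M ⟶ N → f M =βη f N) →
           ∀ {M N} → M =βη N → f M =βη f N
=βη-lift f f-step (step s)    = f-step s
=βη-lift f f-step refl        = refl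
=βη-lift f f-step (sym e)     = sym (=βη-lift f f-step e)
=βη-lift f f-step (trans e e′) = trans (=βη-lift f f-step e) (=βη-lift f f-step e′)

lam-cong : {M M′ : Tm (A ∷ Γ) B} → M =βη M′ → lam M =βη lam M′
lam-cong = =βη-lift lam (λ s → step (ξ-lam s))

app-congˡ : {M M′ : Tm Γ (A ⇒ B)} {N : Tm Γ A} → M =βη M′ → app M N =βη app M′ N
app-congˡ {N = N} = =βη-lift (λ M → app M N) (λ s → step (ξ-app₁ s))

app-congʳ : {M : Tm Γ (A ⇒ B)} {N N′ : Tm Γ A} → N =βη N′ → app M N =βη app M N′
app-congʳ {M = M} = =βη-lift (app M) (λ s → step (ξ-app₂ s))

rename-⟶ : (ρ : Ren Γ Δ) {M N : Tm Γ A} → M ⟶ N → rename ρ M =βη rename ρ N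
rename-⟶ ρ (β {M = M} {N = N}) = trans (step β) (≡⇒=βη (≡.sym (rename-[] ρ M N)))
rename-⟶ ρ (η {M = M})         =
  trans (≡⇒=βη (cong (λ t → lam (app t (var here))) (rename-weaken ρ M))) (step η)
rename-⟶ ρ (ξ-lam s)  = lam-cong (rename-⟶ (ext ρ) s)
rename-⟶ ρ (ξ-app₁ s) = app-congˡ (rename-⟶ ρ s)
rename-⟶ ρ (ξ-app₂ s) = app-congʳ (rename-⟶ ρ s)

rename-=βη : (ρ : Ren Γ Δ) {M N : Tm Γ A} → M =βη N → rename ρ M =βη rename ρ N
rename-=βη ρ = =βη-lift (rename ρ) (rename-⟶ ρ)

-- η-long β-normal forms: a neutral term is normal only at atomic type.
data Ne (Γ : Ctx) : Ty → Set
data Nf (Γ : Ctx) : Ty → Set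

data Ne Γ where
  var : Γ ∋ A → Ne Γ A
  app : Ne Γ (A ⇒ B) → Nf Γ A → Ne Γ B

data Nf Γ where
  ne  : ∀ {n} → Ne Γ (atom n) → Nf Γ (atom n)
  lam : Nf (A ∷ Γ) B → Nf Γ (A ⇒ B)

embNe : Ne Γ A → Tm Γ A
embNf : Nf Γ A → Tm Γ A
embNe (var x)   = var x
embNe (app n m) = app (embNe n) (embNf m)
embNf (ne n)    = embNe n
embNf (lam m)   = lam (embNf m)

renameNe : Ren Γ Δ → Ne Γ A → Ne Δ A
renameNf : Ren Γ Δ → Nf Γ A → Nf Δ A
renameNe ρ (var x)   = var (ρ x)
renameNe ρ (app n m) = app (renameNe ρ n) (renameNf ρ m)
renameNf ρ (ne n)    = ne (renameNe ρ n)
renameNf ρ (lam m)   = lam (renameNf (ext ρ) m)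

embNe-rename : (ρ : Ren Γ Δ) (n : Ne Γ A) → embNe (renameNe ρ n) ≡ rename ρ (embNe n)
embNf-rename : (ρ : Ren Γ Δ) (n : Nf Γ A) → embNf (renameNf ρ n) ≡ rename ρ (embNf n)
embNe-rename ρ (var x)   = refl
embNe-rename ρ (app n m) = cong₂ app (embNe-rename ρ n) (embNf-rename ρ m)
embNf-rename ρ (ne n)    = embNe-rename ρ n
embNf-rename ρ (lam m)   = cong lam (embNf-rename (ext ρ) m)

Sem : Ctx → Ty → Set
Sem Γ (atom n) = Ne Γ (atom n)
Sem Γ (A ⇒ B)  = ∀ {Δ} → Ren Γ Δ → Sem Δ A → Sem Δ B

renameSem : ∀ A → Ren Γ Δ → Sem Γ A → Sem Δ A
renameSem (atom n) ρ v = renameNe ρ v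
renameSem (A ⇒ B)  ρ f = λ ρ′ → f (λ x → ρ′ (ρ x))

reflect : ∀ A → Ne Γ A → Sem Γ A
reify   : ∀ A → Sem Γ A → Nf Γ A
reflect (atom n) n′ = n′
reflect (A ⇒ B)  n  = λ ρ a → reflect B (app (renameNe ρ n) (reify A a))
reify (atom n) v = ne v
reify (A ⇒ B)  f = lam (reify B (f there (reflect A (var here))))

Env : Ctx → Ctx → Set
Env Γ Δ = ∀ {A} → Γ ∋ A → Sem Δ A

eval : Tm Γ A → Env Γ Δ → Sem Δ A
eval (var x)   γ = γ x
eval (lam M)   γ = λ ρ a → eval M ((λ {C} x → renameSem C ρ (γ x)) ◂ a)
eval (app M N) γ = eval M γ (λ x → x) (eval N γ)

nf : Tm Γ A → Nf Γ A
nf {A = A} M = reify A (eval M (λ {C} x → reflect C (var x)))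

R : ∀ A → Tm Γ A → Sem Γ A → Set
R (atom n)         t v = t =βη embNe v
R {Γ} (A ⇒ B) t f = ∀ {Δ} (ρ : Ren Γ Δ) {s : Tm Δ A} {a : Sem Δ A} →
                    R A s a → R B (app (rename ρ t) s) (f ρ a)

R-=βη : ∀ A {t t′ : Tm Γ A} {v : Sem Γ A} → t =βη t′ → R A t′ v → R A t v
R-=βη (atom n) e r = trans e r
R-=βη (A ⇒ B)  e r = λ ρ ra → R-=βη B (app-congˡ (rename-=βη ρ e)) (r ρ ra)

R-rename : ∀ A (ρ : Ren Γ Δ) {t : Tm Γ A} {v : Sem Γ A} →
           R A t v → R A (rename ρ t) (renameSem A ρ v)
R-rename (atom n) ρ {v = v} r = trans (rename-=βη ρ r) (≡⇒=βη (≡.sym (embNe-rename ρ v)))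
R-rename (A ⇒ B)  ρ {t = t} r = λ ρ′ ra →
  R-=βη B (app-congˡ (≡⇒=βη (rename-∘ ρ ρ′ t))) (r (λ x → ρ′ (ρ x)) ra)

reflect-R : ∀ A (n : Ne Γ A) → R A (embNe n) (reflect A n)
reify-R   : ∀ A {t : Tm Γ A} {v : Sem Γ A} → R A t v → t =βη embNf (reify A v)
reflect-R (atom n) n′ = refl
reflect-R (A ⇒ B)  n  = λ ρ {a = a} ra →
  R-=βη B (trans (app-congˡ (≡⇒=βη (≡.sym (embNe-rename ρ n)))) (app-congʳ (reify-R A ra)))
          (reflect-R B (app (renameNe ρ n) (reify A a)))
reify-R (atom n) r = r
reify-R (A ⇒ B)  r = trans (sym (step η)) (lam-cong (reify-R B (r there (reflect-R A (var here)))))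

R-Sub : Sub Γ Δ → Env Γ Δ → Set
R-Sub σ γ = ∀ {B} x → R B (σ x) (γ x)

R-Sub-◂ : (ρ : Ren Δ Θ) {σ : Sub Γ Δ} {γ : Env Γ Δ} {s : Tm Θ A} {a : Sem Θ A} →
          R-Sub σ γ → R A s a →
          R-Sub ((λ x → rename ρ (σ x)) ◂ s) ((λ {C} x → renameSem C ρ (γ x)) ◂ a)
R-Sub-◂ ρ h ra here      = ra
R-Sub-◂ ρ h ra (there x) = R-rename _ ρ (h x)

fundamental : (M : Tm Γ A) {σ : Sub Γ Δ} {γ : Env Γ Δ} →
              R-Sub σ γ → R A (subst σ M) (eval M γ)
fundamental (var x) h = h x
fundamental {A = A ⇒ B} (lam M) {σ} h = λ ρ {s} ra →
  R-=βη B (trans (app-congˡ (≡⇒=βη (rename-subst σ ρ (lam M))))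
          (trans (step β) (≡⇒=βη (subst-exts-[] (λ x → rename ρ (σ x)) M s))))
          (fundamental M (R-Sub-◂ ρ h ra))
fundamental (app M N) {σ} h =
  R-=βη _ (app-congˡ (≡⇒=βη (≡.sym (rename-id (subst σ M)))))
          (fundamental M h (λ x → x) (fundamental N h))

nf-sound : (M : Tm Γ A) → M =βη embNf (nf M)
nf-sound {A = A} M = trans (≡⇒=βη (≡.sym (subst-var M)))
                           (reify-R A (fundamental M (λ {C} x → reflect-R C (var x))))

target : Ty → ℕ
target (atom n) = n
target (A ⇒ B)  = target B

target-φ : ∀ i → target (φ (suc i)) ≡ suc i
target-φ zero    = refl
target-φ (suc i) = refl

φ-suc-injective : φ (suc i) ≡ φ (suc j) → i ≡ j
φ-suc-injective {i} {j} eq =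
  suc-injective (≡.trans (≡.sym (target-φ i)) (≡.trans (cong target eq) (target-φ j)))

AllΦ≥ : ℕ → Ctx → Set
AllΦ≥ m Γ = ∀ {C} → Γ ∋ C → ∃[ i ] C ≡ φ (suc i) × m ≤ i

OneVarPerType : Ctx → Set
OneVarPerType Γ = ∀ {C} (x y : Γ ∋ C) → x ≡ y

AllΦ≥-∷ : AllΦ≥ (suc m) Γ → AllΦ≥ m (φ (suc m) ∷ Γ)
AllΦ≥-∷ {m} Φ here      = m , refl , ≤-refl
AllΦ≥-∷     Φ (there y) = map₂ (map₂ <⇒≤) (Φ y)

OneVarPerType-∷ : AllΦ≥ (suc m) Γ → OneVarPerType Γ → OneVarPerType (φ (suc m) ∷ Γ)
OneVarPerType-∷ Φ U here      here      = refl
OneVarPerType-∷ Φ U here      (there y) with Φ y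
... | i , eq , m<i = ⊥-elim (<-irrefl (φ-suc-injective eq) m<i)
OneVarPerType-∷ Φ U (there x) here      = ≡.sym (OneVarPerType-∷ Φ U here (there x))
OneVarPerType-∷ Φ U (there x) (there y) = cong there (U x y)

-- Every φ-type has an atomic codomain, so a neutral of arrow type has no arguments.
Ne-⇒-var : AllΦ≥ m Γ → (n : Ne Γ (A ⇒ B)) → ∃[ y ] n ≡ var y
Ne-⇒-var Φ (var y)   = y , refl
Ne-⇒-var Φ (app n _) with Ne-⇒-var Φ n
... | y , refl with Φ y
...   | zero  , () , _
...   | suc _ , () , _

Nf-φ-=βη-var : ∀ m → AllΦ≥ m Γ → OneVarPerType Γ → (x : Γ ∋ φ (suc m)) →
               (n : Nf Γ (φ (suc m))) → embNf n =βη var x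
Nf-φ-=βη-var zero Φ U x (ne (var y)) = ≡⇒=βη (cong var (U y x))
Nf-φ-=βη-var zero Φ U x (ne (app n _)) with Ne-⇒-var Φ n
... | y , refl with Φ y
...   | zero  , () , _
...   | suc _ , () , _
Nf-φ-=βη-var (suc m) Φ U x (lam (ne (var y))) with AllΦ≥-∷ Φ y
... | zero  , () , _
... | suc _ , () , _
Nf-φ-=βη-var (suc m) Φ U x (lam (ne (app n N))) with Ne-⇒-var (AllΦ≥-∷ Φ) n
... | y , refl with AllΦ≥-∷ Φ y
...   | zero  , () , _
...   | suc _ , refl , _ with OneVarPerType-∷ Φ U y (there x)
...     | refl = trans (lam-cong (app-congʳ N=βηvar)) (step η)
  where
  N=βηvar : embNf N =βη var here
  N=βηvar = Nf-φ-=βη-var m (AllΦ≥-∷ Φ) (OneVarPerType-∷ Φ U) here N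

lemma4p1 : (k : ℕ) → 1 ≤ k → (M : Tm [] (φ k ⇒ φ k)) → M =βη idTm (φ k)
lemma4p1 zero    () M
lemma4p1 (suc k) _  M = trans (nf-sound M) (closed-nf (nf M))
  where
  closed-nf : (n : Nf [] (φ (suc k) ⇒ φ (suc k))) → embNf n =βη idTm (φ (suc k))
  closed-nf (lam N) =
    lam-cong (Nf-φ-=βη-var k (AllΦ≥-∷ (λ ())) (OneVarPerType-∷ (λ ()) (λ ())) here N)
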